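{- Let $c\ge 2$ and $b\ge c+2$ be integers. Let $H$ be a simple graph with two vertices $x,t$ of degree $1$ and all other vertices (called inner vertices) of degree $b+c$; let $y$ be the neighbor of $x$ and $s$ the neighbor of $t$. Suppose the number of inner vertices of $H$ is divisible by $4$. Let $\varphi:V(H)\to\{\mathrm{red},\mathrm{blue}\}$ be a coloring such that every inner vertex has exactly $b$ neighbors of its own color (and hence exactly $c$ neighbors of the other color). Then either $\varphi(x)=\varphi(y)=\varphi(s)=\varphi(t)$, or $\varphi(x)=\varphi(s)\ne\varphi(y)=\varphi(t)$. -}

module Defs where

open import Data.Nat using (ℕ; zero; suc)
open import Data.Bool using (Bool; true; false; _∧_; if_then_else_)
open import Data.Fin using (Fin; zero; suc)
open import Relation.Binary.PropositionalEquality using (_≡_)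

count : ∀ {n} → (Fin n → Bool) → ℕ
count {zero}  P = 0
count {suc n} P = (if P zero then 1 else 0) + count (λ i → P (suc i))
  where open Data.Nat using (_+_)

record SimpleGraph (n : ℕ) : Set where
  field
    adj    : Fin n → Fin n → Bool
    sym    : ∀ u v → adj u v ≡ adj v u
    irrefl : ∀ v → adj v v ≡ false

open SimpleGraph public

degree : ∀ {n} → SimpleGraph n → Fin n → ℕ
degree G v = count (λ u → adj G v u)

-- colours: Bool (true = red, false = blue)
Colour : Set
Colour = Bool

_==ᶜ_ : Colour → Colour → Bool
true  ==ᶜ true  = true
false ==ᶜ false = true
_     ==ᶜ _     = false

sameColourDegree : ∀ {n} → SimpleGraph n → (Fin n → Colour) → Fin n → ℕ
sameColourDegree G φ v = count (λ u → adj G v u ∧ (φ u ==ᶜ φ v))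

{-# OPTIONS --safe #-}
-- Count the edges between red and blue vertices from both sides. Inner vertices have c
-- neighbours of the other colour and each pendant vertex at most one, so a + c R = a′ + c B
-- with a, a′ ≤ 2, where R and B count the red and blue inner vertices. Since c ≥ 2 this
-- forces |R − B| ≤ 1, and 4 ∣ R + B then gives R = B, both even, hence a = a′. Counting the
-- edges inside one colour class from both ends, b R plus the same-colour contribution of the
-- pendant vertices is even, so that contribution is even in each colour. Only the two colour
-- patterns of the conclusion survive these constraints.
module Submission where

open import Defs hiding (sym)
open import Data.Bool using (Bool; true; false; _∧_; not; if_then_else_)
open import Data.Empty using (⊥-elim)
open import Data.Fin using (Fin; zero; suc)
open import Data.Fin.Properties using (_≟_)
open import Data.Nat using (ℕ; zero; suc; _+_; _*_; _≤_; _≥_; _∸_; z≤n; s≤s)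
open import Data.Nat.Divisibility
  using (_∣_; divides; _∣0; ∣-trans; ∣1⇒≡1; ∣m∣n⇒∣m+n; ∣m+n∣m⇒∣n; ∣n⇒∣m*n; *-cancelˡ-∣)
open import Data.Nat.Properties hiding (_≟_)
open import Algebra.Bundles using (CommutativeMonoid)
open import Data.Bool.Properties using (∧-commutativeMonoid; ∧-zeroʳ)
open import Algebra.Properties.CommutativeSemigroup
  (CommutativeMonoid.commutativeSemigroup ∧-commutativeMonoid) using (x∙yz≈z∙yx)
open import Algebra.Properties.Semiring.Sum +-*-semiring
  using (sum; sum-syntax; sum-cong-≗; sum-replicate-zero; ∑-distrib-+; ∑-comm; *-distribˡ-sum)
open import Data.Nat.Tactic.RingSolver using (solve-∀)
open import Data.Product using (_×_; _,_; proj₁; proj₂)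
open import Data.Sum using (_⊎_; inj₁; inj₂)
open import Function using (_∘_)
open import Relation.Nullary using (¬_; does; yes; no)
open import Relation.Binary.PropositionalEquality
open ≡-Reasoning

𝟙 : Bool → ℕ
𝟙 b = if b then 1 else 0

𝟙-∧ : ∀ a b → 𝟙 (a ∧ b) ≡ 𝟙 a * 𝟙 b
𝟙-∧ true  b = sym (*-identityˡ (𝟙 b))
𝟙-∧ false b = refl

𝟙*𝟙≤1 : ∀ a b → 𝟙 a * 𝟙 b ≤ 1
𝟙*𝟙≤1 true  true  = s≤s z≤n
𝟙*𝟙≤1 true  false = z≤n
𝟙*𝟙≤1 false b     = z≤n

count≡∑ : ∀ {n} (P : Fin n → Bool) → count P ≡ ∑[ i < n ] 𝟙 (P i)
count≡∑ {zero}  P = refl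
count≡∑ {suc n} P = cong (𝟙 (P zero) +_) (count≡∑ (P ∘ suc))

count-cong : ∀ {n} {P Q : Fin n → Bool} → (∀ i → P i ≡ Q i) → count P ≡ count Q
count-cong {zero}  P≗Q = refl
count-cong {suc n} P≗Q = cong₂ _+_ (cong 𝟙 (P≗Q zero)) (count-cong (P≗Q ∘ suc))

∑-const-1 : ∀ n → ∑[ i < n ] 1 ≡ n
∑-const-1 zero    = refl
∑-const-1 (suc n) = cong suc (∑-const-1 n)

∑-scale : ∀ {n} d (f g : Fin n → ℕ) → (∀ i → f i ≡ d * g i) → sum f ≡ d * sum g
∑-scale d f g f≗dg = trans (sum-cong-≗ f≗dg) (sym (*-distribˡ-sum d g))

∑-pick : ∀ {n} (x : Fin n) (g : Fin n → ℕ) → ∑[ v < n ] (𝟙 (does (v ≟ x)) * g v) ≡ g x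
∑-pick {suc n} zero    g = begin
  1 * g zero + ∑[ v < n ] 0  ≡⟨ cong₂ _+_ (*-identityˡ (g zero)) (sum-replicate-zero n) ⟩
  g zero + 0                 ≡⟨ +-identityʳ (g zero) ⟩
  g zero                     ∎
∑-pick {suc n} (suc x) g = ∑-pick x (g ∘ suc)

outside : ∀ {n} → Fin n → Fin n → Fin n → Bool
outside x t v = not (does (v ≟ x)) ∧ not (does (v ≟ t))

outside⇒≢ : ∀ {n} {x t v : Fin n} → outside x t v ≡ true → v ≢ x × v ≢ t
outside⇒≢ {x = x} {t} {v} with v ≟ x | v ≟ t
... | yes _   | _       = λ ()
... | no  v≢x | yes _   = λ ()
... | no  v≢x | no  v≢t = λ _ → v≢x , v≢t

∑-split₂ : ∀ {n} {x t : Fin n} → x ≢ t → (g : Fin n → ℕ) →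
  sum g ≡ g x + g t + ∑[ v < n ] (𝟙 (outside x t v) * g v)
∑-split₂ {n} {x} {t} x≢t g = begin
  sum g
    ≡⟨ sum-cong-≗ partition ⟩
  ∑[ v < n ] (pick x v + pick t v + rest v)
    ≡⟨ ∑-distrib-+ (λ v → pick x v + pick t v) rest ⟩
  ∑[ v < n ] (pick x v + pick t v) + sum rest
    ≡⟨ cong (_+ sum rest) (∑-distrib-+ (pick x) (pick t)) ⟩
  sum (pick x) + sum (pick t) + sum rest
    ≡⟨ cong₂ (λ a b → a + b + sum rest) (∑-pick x g) (∑-pick t g) ⟩
  g x + g t + sum rest
    ∎
  where
  pick : Fin n → Fin n → ℕ
  pick z v = 𝟙 (does (v ≟ z)) * g v
  rest : Fin n → ℕ
  rest v = 𝟙 (outside x t v) * g v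
  partition : ∀ v → g v ≡ pick x v + pick t v + rest v
  partition v with v ≟ x | v ≟ t
  ... | yes refl | yes refl = ⊥-elim (x≢t refl)
  ... | yes refl | no _     = sym (trans (+-identityʳ _) (trans (+-identityʳ _) (*-identityˡ (g v))))
  ... | no _     | yes refl = sym (trans (+-identityʳ _) (*-identityˡ (g v)))
  ... | no _     | no _     = sym (*-identityˡ (g v))

count≡1⇒singleton : ∀ {n} {A : Fin n → Bool} {y : Fin n} → count A ≡ 1 → A y ≡ true →
  ∀ u → A u ≡ does (u ≟ y)
count≡1⇒singleton {n} {A} {y} count≡1 Ay u with u ≟ y
... | yes refl = Ay
... | no  u≢y  with A u in Au
...   | false = refl
...   | true  = ⊥-elim (1+n≢0 (suc-injective (begin
  2 + others                  ≡⟨ cong₂ (λ a b → 𝟙 a + 𝟙 b + others) (sym Ay) (sym Au) ⟩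
  𝟙 (A y) + 𝟙 (A u) + others  ≡⟨ sym (∑-split₂ (u≢y ∘ sym) (𝟙 ∘ A)) ⟩
  ∑[ v < n ] 𝟙 (A v)          ≡⟨ sym (count≡∑ A) ⟩
  count A                     ≡⟨ count≡1 ⟩
  1                           ∎)))
  where
  others : ℕ
  others = ∑[ v < n ] (𝟙 (outside y u v) * 𝟙 (A v))

count-∧-singleton : ∀ {n} {A : Fin n → Bool} {y : Fin n} (P : Fin n → Bool) →
  count A ≡ 1 → A y ≡ true → count (λ u → A u ∧ P u) ≡ 𝟙 (P y)
count-∧-singleton {n} {A} {y} P count≡1 Ay = begin
  count (λ u → A u ∧ P u)                  ≡⟨ count≡∑ (λ u → A u ∧ P u) ⟩
  ∑[ u < n ] 𝟙 (A u ∧ P u)                 ≡⟨ sum-cong-≗ at-y ⟩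
  ∑[ u < n ] (𝟙 (does (u ≟ y)) * 𝟙 (P u))  ≡⟨ ∑-pick y (𝟙 ∘ P) ⟩
  𝟙 (P y)                                  ∎
  where
  at-y : ∀ u → 𝟙 (A u ∧ P u) ≡ 𝟙 (does (u ≟ y)) * 𝟙 (P u)
  at-y u = trans (cong (λ a → 𝟙 (a ∧ P u)) (count≡1⇒singleton count≡1 Ay u)) (𝟙-∧ _ (P u))

module _ {n} (G : SimpleGraph n) where

  neighboursIn : (Fin n → Bool) → Fin n → ℕ
  neighboursIn B v = count (λ u → adj G v u ∧ B u)

  neighboursIn-pendant : ∀ {x y} (B : Fin n → Bool) → degree G x ≡ 1 → adj G x y ≡ true →
    neighboursIn B x ≡ 𝟙 (B y)
  neighboursIn-pendant B = count-∧-singleton B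

  degree-split : ∀ (B : Fin n → Bool) v → neighboursIn B v + neighboursIn (not ∘ B) v ≡ degree G v
  degree-split B v = begin
    neighboursIn B v + neighboursIn (not ∘ B) v
      ≡⟨ cong₂ _+_ (count≡∑ (λ u → adj G v u ∧ B u)) (count≡∑ (λ u → adj G v u ∧ not (B u))) ⟩
    ∑[ u < n ] 𝟙 (adj G v u ∧ B u) + ∑[ u < n ] 𝟙 (adj G v u ∧ not (B u))
      ≡⟨ sym (∑-distrib-+ (λ u → 𝟙 (adj G v u ∧ B u)) (λ u → 𝟙 (adj G v u ∧ not (B u)))) ⟩
    ∑[ u < n ] (𝟙 (adj G v u ∧ B u) + 𝟙 (adj G v u ∧ not (B u)))
      ≡⟨ sum-cong-≗ (λ u → split (adj G v u) (B u)) ⟩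
    ∑[ u < n ] 𝟙 (adj G v u)
      ≡⟨ sym (count≡∑ (adj G v)) ⟩
    degree G v
      ∎
    where
    split : ∀ a b → 𝟙 (a ∧ b) + 𝟙 (a ∧ not b) ≡ 𝟙 a
    split true  true  = refl
    split true  false = refl
    split false b     = refl

  edgesBetween : (Fin n → Bool) → (Fin n → Bool) → ℕ
  edgesBetween A B = ∑[ v < n ] (𝟙 (A v) * neighboursIn B v)

  isArc : (Fin n → Bool) → (Fin n → Bool) → Fin n → Fin n → Bool
  isArc A B v u = A v ∧ (adj G v u ∧ B u)

  isArc-sym : ∀ A B v u → isArc A B v u ≡ isArc B A u v
  isArc-sym A B v u =
    trans (x∙yz≈z∙yx (A v) (adj G v u) (B u)) (cong (λ e → B u ∧ (e ∧ A v)) (SimpleGraph.sym G v u))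

  edgesBetween≡∑∑isArc : ∀ A B → edgesBetween A B ≡ ∑[ v < n ] ∑[ u < n ] 𝟙 (isArc A B v u)
  edgesBetween≡∑∑isArc A B = sum-cong-≗ λ v → begin
    𝟙 (A v) * neighboursIn B v
      ≡⟨ cong (𝟙 (A v) *_) (count≡∑ (λ u → adj G v u ∧ B u)) ⟩
    𝟙 (A v) * ∑[ u < n ] 𝟙 (adj G v u ∧ B u)
      ≡⟨ *-distribˡ-sum (𝟙 (A v)) (λ u → 𝟙 (adj G v u ∧ B u)) ⟩
    ∑[ u < n ] (𝟙 (A v) * 𝟙 (adj G v u ∧ B u))
      ≡⟨ sum-cong-≗ (λ u → sym (𝟙-∧ (A v) (adj G v u ∧ B u))) ⟩
    ∑[ u < n ] 𝟙 (isArc A B v u)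
      ∎

  edgesBetween-comm : ∀ A B → edgesBetween A B ≡ edgesBetween B A
  edgesBetween-comm A B = begin
    edgesBetween A B
      ≡⟨ edgesBetween≡∑∑isArc A B ⟩
    ∑[ v < n ] ∑[ u < n ] 𝟙 (isArc A B v u)
      ≡⟨ sum-cong-≗ (λ v → sum-cong-≗ (λ u → cong 𝟙 (isArc-sym A B v u))) ⟩
    ∑[ v < n ] ∑[ u < n ] 𝟙 (isArc B A u v)
      ≡⟨ ∑-comm (λ v u → 𝟙 (isArc B A u v)) ⟩
    ∑[ u < n ] ∑[ v < n ] 𝟙 (isArc B A u v)
      ≡⟨ sym (edgesBetween≡∑∑isArc B A) ⟩
    edgesBetween B A
      ∎

2∣m+m : ∀ m → 2 ∣ m + m
2∣m+m m = divides m (trans (cong (m +_) (sym (+-identityʳ m))) (*-comm 2 m))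

2∤1+m+m : ∀ m → ¬ 2 ∣ suc (m + m)
2∤1+m+m m 2∣odd with ∣1⇒≡1 (∣m+n∣m⇒∣n (subst (2 ∣_) (+-comm 1 (m + m)) 2∣odd) (2∣m+m m))
... | ()

4∣m+m⇒2∣m : ∀ {m} → 4 ∣ m + m → 2 ∣ m
4∣m+m⇒2∣m {m} 4∣m+m = *-cancelˡ-∣ 2 (subst (4 ∣_) (cong (m +_) (sym (+-identityʳ m))) 4∣m+m)

-- The diagonal vanishes and the off-diagonal terms come in equal pairs f i j = f j i.
∑∑-symmetric-even : ∀ {n} (f : Fin n → Fin n → ℕ) →
  (∀ i j → f i j ≡ f j i) → (∀ i → f i i ≡ 0) → 2 ∣ ∑[ i < n ] ∑[ j < n ] f i j
∑∑-symmetric-even {zero}  f f-sym f-diag = 2 ∣0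
∑∑-symmetric-even {suc n} f f-sym f-diag =
  subst (2 ∣_) (sym ∑∑f≡) (∣m∣n⇒∣m+n (2∣m+m row₀)
    (∑∑-symmetric-even (λ i j → f (suc i) (suc j)) (λ i j → f-sym (suc i) (suc j)) (f-diag ∘ suc)))
  where
  row₀ rest : ℕ
  row₀ = ∑[ j < n ] f zero (suc j)
  rest = ∑[ i < n ] ∑[ j < n ] f (suc i) (suc j)
  ∑∑f≡ : ∑[ i < suc n ] ∑[ j < suc n ] f i j ≡ row₀ + row₀ + rest
  ∑∑f≡ = begin
    (f zero zero + row₀) + ∑[ i < n ] (f (suc i) zero + ∑[ j < n ] f (suc i) (suc j))
      ≡⟨ cong₂ _+_ (cong (_+ row₀) (f-diag zero))
                   (∑-distrib-+ (λ i → f (suc i) zero) (λ i → ∑[ j < n ] f (suc i) (suc j))) ⟩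
    row₀ + (∑[ i < n ] f (suc i) zero + rest)
      ≡⟨ cong (λ col₀ → row₀ + (col₀ + rest)) (sum-cong-≗ (λ i → f-sym (suc i) zero)) ⟩
    row₀ + (row₀ + rest)
      ≡⟨ sym (+-assoc row₀ row₀ rest) ⟩
    row₀ + row₀ + rest
      ∎

edgesBetween-self-even : ∀ {n} (G : SimpleGraph n) A → 2 ∣ edgesBetween G A A
edgesBetween-self-even G A = subst (2 ∣_) (sym (edgesBetween≡∑∑isArc G A A))
  (∑∑-symmetric-even _ (λ v u → cong 𝟙 (isArc-sym G A A v u)) no-loops)
  where
  no-loops : ∀ v → 𝟙 (isArc G A A v v) ≡ 0
  no-loops v = cong 𝟙 (trans (cong (λ e → A v ∧ (e ∧ A v)) (irrefl G v)) (∧-zeroʳ (A v)))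

-- a = a′ + c d with a ≤ 2 ≤ c forces d ≤ 1, and d = 1 would make m + (m + d) odd.
difference-vanishes : ∀ {c a a′ m d} → 2 ≤ c → a ≤ 2 →
  a + c * m ≡ a′ + c * (m + d) → 2 ∣ m + (m + d) → d ≡ 0
difference-vanishes {c} {a} {a′} {m} {d} c≥2 a≤2 eq 2∣sum = vanish d cd≤2 2∣sum
  where
  rearrange : ∀ a′ c m d → a′ + c * (m + d) ≡ a′ + c * d + c * m
  rearrange = solve-∀
  a≡ : a ≡ a′ + c * d
  a≡ = +-cancelʳ-≡ (c * m) a _ (trans eq (rearrange a′ c m d))
  cd≤2 : c * d ≤ 2
  cd≤2 = ≤-trans (m≤n+m (c * d) a′) (subst (_≤ 2) a≡ a≤2)
  vanish : ∀ e → c * e ≤ 2 → 2 ∣ m + (m + e) → e ≡ 0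
  vanish zero          _     _      = refl
  vanish (suc zero)    _     2∣odd  =
    ⊥-elim (2∤1+m+m m (subst (2 ∣_) (trans (cong (m +_) (+-comm m 1)) (+-suc m m)) 2∣odd))
  vanish (suc (suc e)) ce≤2 _ with ≤-trans (*-mono-≤ c≥2 (s≤s (s≤s (z≤n {e})))) ce≤2
  ... | s≤s (s≤s ())

balance : ∀ {c a a′ m n} → 2 ≤ c → a ≤ 2 → a′ ≤ 2 →
  a + c * m ≡ a′ + c * n → 2 ∣ m + n → m ≡ n
balance {m = m} {n} c≥2 a≤2 a′≤2 eq 2∣m+n with ≤-total m n
... | inj₁ m≤n with m≤n⇒∃[o]m+o≡n m≤n
...   | d , refl = sym (trans (cong (m +_) (difference-vanishes c≥2 a≤2 eq 2∣m+n)) (+-identityʳ m))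
balance {m = m} {n} c≥2 a≤2 a′≤2 eq 2∣m+n | inj₂ n≤m with m≤n⇒∃[o]m+o≡n n≤m
...   | d , refl = trans (cong (n +_) (difference-vanishes c≥2 a′≤2 (sym eq)
                      (subst (2 ∣_) (+-comm (n + d) n) 2∣m+n))) (+-identityʳ n)

==ᶜ-not : ∀ a k → (a ==ᶜ not k) ≡ not (a ==ᶜ k)
==ᶜ-not true  true  = refl
==ᶜ-not true  false = refl
==ᶜ-not false true  = refl
==ᶜ-not false false = refl

==ᶜ⇒≡ : ∀ {a k} → (a ==ᶜ k) ≡ true → a ≡ k
==ᶜ⇒≡ {true}  {true}  _ = refl
==ᶜ⇒≡ {false} {false} _ = refl

𝟙-colours : ∀ a → 𝟙 (a ==ᶜ true) + 𝟙 (a ==ᶜ false) ≡ 1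
𝟙-colours true  = refl
𝟙-colours false = refl

-- Pendant edges x y and t s oriented from a k-coloured to a k′-coloured end.
pendantArcs : (k k′ X Y T S : Colour) → ℕ
pendantArcs k k′ X Y T S = 𝟙 (X ==ᶜ k) * 𝟙 (Y ==ᶜ k′) + 𝟙 (T ==ᶜ k) * 𝟙 (S ==ᶜ k′)

pendantArcs≤2 : ∀ k k′ X Y T S → pendantArcs k k′ X Y T S ≤ 2
pendantArcs≤2 k k′ X Y T S = +-mono-≤ (𝟙*𝟙≤1 (X ==ᶜ k) _) (𝟙*𝟙≤1 (T ==ᶜ k) _)

pendantColourings : ∀ X Y T S →
  pendantArcs true false X Y T S ≡ pendantArcs false true X Y T S →
  2 ∣ pendantArcs true true X Y T S → 2 ∣ pendantArcs false false X Y T S →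
  (X ≡ Y × Y ≡ S × S ≡ T) ⊎ (X ≡ S × Y ≡ T × X ≢ Y)
pendantColourings true  true  true  true  _  _    _    = inj₁ (refl , refl , refl)
pendantColourings true  true  true  false _  2∣1 _    = ⊥-elim (2∤1+m+m 0 2∣1)
pendantColourings true  true  false true  _  2∣1 _    = ⊥-elim (2∤1+m+m 0 2∣1)
pendantColourings true  true  false false _  2∣1 _    = ⊥-elim (2∤1+m+m 0 2∣1)
pendantColourings true  false true  true  () _    _
pendantColourings true  false true  false () _    _
pendantColourings true  false false true  _  _    _    = inj₂ (refl , refl , λ ())
pendantColourings true  false false false () _    _
pendantColourings false true  true  true  () _    _
pendantColourings false true  true  false _  _    _    = inj₂ (refl , refl , λ ())
pendantColourings false true  false true  () _    _
pendantColourings false true  false false () _    _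
pendantColourings false false true  true  _  _    2∣1 = ⊥-elim (2∤1+m+m 0 2∣1)
pendantColourings false false true  false () _    _
pendantColourings false false false true  () _    _
pendantColourings false false false false _  _    _    = inj₁ (refl , refl , refl)

module PendantPair
  {n} (b c : ℕ) (H : SimpleGraph n) (x t y s : Fin n) (x≢t : x ≢ t)
  (deg-x : degree H x ≡ 1) (deg-t : degree H t ≡ 1) (x~y : adj H x y ≡ true) (t~s : adj H t s ≡ true)
  (deg-inner : ∀ v → v ≢ x → v ≢ t → degree H v ≡ b + c)
  (φ : Fin n → Colour) (same-inner : ∀ v → v ≢ x → v ≢ t → sameColourDegree H φ v ≡ b)
  where

  inner : Fin n → Bool
  inner = outside x t

  class : Colour → Fin n → Bool
  class k v = φ v ==ᶜ k

  innerSize : Colour → ℕ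
  innerSize k = ∑[ v < n ] (𝟙 (inner v) * 𝟙 (class k v))

  arcs : Colour → Colour → ℕ
  arcs k k′ = pendantArcs k k′ (φ x) (φ y) (φ t) (φ s)

  arcs≤2 : ∀ k k′ → arcs k k′ ≤ 2
  arcs≤2 k k′ = pendantArcs≤2 k k′ (φ x) (φ y) (φ t) (φ s)

  inner-same : ∀ {v k} → v ≢ x → v ≢ t → φ v ≡ k → neighboursIn H (class k) v ≡ b
  inner-same {v} v≢x v≢t refl = same-inner v v≢x v≢t

  inner-other : ∀ {v k} → v ≢ x → v ≢ t → φ v ≡ k → neighboursIn H (class (not k)) v ≡ c
  inner-other {v} {k} v≢x v≢t refl = +-cancelˡ-≡ b _ c (begin
    b + neighboursIn H (class (not k)) v
      ≡⟨ cong₂ _+_ (sym (same-inner v v≢x v≢t))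
                   (count-cong (λ u → cong (adj H v u ∧_) (==ᶜ-not (φ u) k))) ⟩
    neighboursIn H (class k) v + neighboursIn H (not ∘ class k) v
      ≡⟨ degree-split H (class k) v ⟩
    degree H v
      ≡⟨ deg-inner v v≢x v≢t ⟩
    b + c
      ∎)

  edgesBetween-classes : ∀ k k′ {d} →
    (∀ {v} → v ≢ x → v ≢ t → φ v ≡ k → neighboursIn H (class k′) v ≡ d) →
    edgesBetween H (class k) (class k′) ≡ arcs k k′ + d * innerSize k
  edgesBetween-classes k k′ {d} inner-degree = begin
    edgesBetween H (class k) (class k′)
      ≡⟨ ∑-split₂ x≢t _ ⟩
    𝟙 (class k x) * neighboursIn H (class k′) x + 𝟙 (class k t) * neighboursIn H (class k′) t
      + ∑[ v < n ] (𝟙 (inner v) * (𝟙 (class k v) * neighboursIn H (class k′) v))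
      ≡⟨ cong₂ _+_ (cong₂ _+_ (cong (𝟙 (class k x) *_) (neighboursIn-pendant H (class k′) deg-x x~y))
                              (cong (𝟙 (class k t) *_) (neighboursIn-pendant H (class k′) deg-t t~s)))
                   (∑-scale d _ _ inner-term) ⟩
    arcs k k′ + d * innerSize k
      ∎
    where
    inner-term : ∀ v → 𝟙 (inner v) * (𝟙 (class k v) * neighboursIn H (class k′) v)
                         ≡ d * (𝟙 (inner v) * 𝟙 (class k v))
    inner-term v with inner v in v-inner | class k v in v∈k
    ... | false | _     = sym (*-zeroʳ d)
    ... | true  | false = sym (*-zeroʳ d)
    ... | true  | true  = begin
      1 * (1 * neighboursIn H (class k′) v)  ≡⟨ *-identityˡ _ ⟩
      1 * neighboursIn H (class k′) v        ≡⟨ *-identityˡ _ ⟩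
      neighboursIn H (class k′) v            ≡⟨ inner-degree v≢x v≢t (==ᶜ⇒≡ v∈k) ⟩
      d                                      ≡⟨ sym (*-identityʳ d) ⟩
      d * 1                                  ∎
      where
      v≢x = proj₁ (outside⇒≢ v-inner)
      v≢t = proj₂ (outside⇒≢ v-inner)

  innerSizes : innerSize true + innerSize false ≡ n ∸ 2
  innerSizes = begin
    innerSize true + innerSize false
      ≡⟨ sym (∑-distrib-+ (λ v → 𝟙 (inner v) * 𝟙 (class true v))
                          (λ v → 𝟙 (inner v) * 𝟙 (class false v))) ⟩
    ∑[ v < n ] (𝟙 (inner v) * 𝟙 (class true v) + 𝟙 (inner v) * 𝟙 (class false v))
      ≡⟨ sum-cong-≗ (λ v → trans (sym (*-distribˡ-+ (𝟙 (inner v)) _ _))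
                                 (cong (𝟙 (inner v) *_) (𝟙-colours (φ v)))) ⟩
    ∑[ v < n ] (𝟙 (inner v) * 1)
      ≡⟨ sym (m+n∸m≡n 2 _) ⟩
    2 + ∑[ v < n ] (𝟙 (inner v) * 1) ∸ 2
      ≡⟨ cong (_∸ 2) (sym (trans (sym (∑-const-1 n)) (∑-split₂ x≢t (λ _ → 1)))) ⟩
    n ∸ 2
      ∎

lemma26 : (b c n : ℕ) → c ≥ 2 → b ≥ c + 2 →
    (H : SimpleGraph n) → (x t y s : Fin n) → x ≢ t →
    degree H x ≡ 1 → degree H t ≡ 1 →
    adj H x y ≡ true → adj H t s ≡ true →
    (∀ v → v ≢ x → v ≢ t → degree H v ≡ b + c) →
    4 ∣ (n ∸ 2) →
    (φ : Fin n → Colour) →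
    (∀ v → v ≢ x → v ≢ t → sameColourDegree H φ v ≡ b) →
    (φ x ≡ φ y × φ y ≡ φ s × φ s ≡ φ t)
      ⊎ (φ x ≡ φ s × φ y ≡ φ t × φ x ≢ φ y)
lemma26 b c n c≥2 _ H x t y s x≢t deg-x deg-t x~y t~s deg-inner 4∣n∸2 φ same-inner =
  pendantColourings (φ x) (φ y) (φ t) (φ s) arcs-balanced (arcs-even true) (arcs-even false)
  where
  open PendantPair b c H x t y s x≢t deg-x deg-t x~y t~s deg-inner φ same-inner

  crossing : arcs true false + c * innerSize true ≡ arcs false true + c * innerSize false
  crossing = begin
    arcs true false + c * innerSize true       ≡⟨ sym (edgesBetween-classes true false inner-other) ⟩
    edgesBetween H (class true) (class false)  ≡⟨ edgesBetween-comm H (class true) (class false) ⟩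
    edgesBetween H (class false) (class true)  ≡⟨ edgesBetween-classes false true inner-other ⟩
    arcs false true + c * innerSize false      ∎

  sizes-equal : innerSize true ≡ innerSize false
  sizes-equal = balance c≥2 (arcs≤2 true false) (arcs≤2 false true) crossing
    (subst (2 ∣_) (sym innerSizes) (∣-trans (divides 2 refl) 4∣n∸2))

  arcs-balanced : arcs true false ≡ arcs false true
  arcs-balanced = +-cancelʳ-≡ (c * innerSize false) (arcs true false) (arcs false true)
    (trans (cong (λ m → arcs true false + c * m) (sym sizes-equal)) crossing)

  size-even : ∀ k → 2 ∣ innerSize k
  size-even true  = 4∣m+m⇒2∣m (subst (4 ∣_)
    (sym (trans (cong (innerSize true +_) sizes-equal) innerSizes)) 4∣n∸2)
  size-even false = 4∣m+m⇒2∣m (subst (4 ∣_)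
    (sym (trans (cong (_+ innerSize false) (sym sizes-equal)) innerSizes)) 4∣n∸2)

  arcs-even : ∀ k → 2 ∣ arcs k k
  arcs-even k = ∣m+n∣m⇒∣n
    (subst (2 ∣_) (trans (edgesBetween-classes k k inner-same) (+-comm (arcs k k) (b * innerSize k)))
      (edgesBetween-self-even H (class k)))
    (∣n⇒∣m*n b (size-even k))
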